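{- Fix $n$. If $K_{s_1}^{t_1}$ and $K_{s_2}^{t_2}$ are two graphs with $2\leq t_i\leq s_i$ and $s_i+t_i=n$ ($i=1,2$) which are $D$-cospectral, then $K_{s_1}^{t_1}\cong K_{s_2}^{t_2}$. That is, no two non-isomorphic graphs in the family $\{K_s^t : 2\leq t\leq s,\ s+t=n\}$ are $D$-cospectral.
   Context: All graphs are simple, undirected and connected. $D(G)$ is the distance matrix of $G$ (entries are shortest-path distances); two graphs are $D$-cospectral if their distance matrices have the same spectrum. For $2\leq t\leq s$, $K_s^t$ is the graph on $n=s+t$ vertices obtained from the complete graph $K_s$ by attaching a pendant edge (to a new vertex) at each of $t$ distinct vertices of $K_s$. -}

module Defs where

open import Data.Bool using (Bool; true; false; _∧_; _∨_; if_then_else_)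
open import Data.Nat using (ℕ; zero; suc; _<_; _+_)
open import Data.Fin using (Fin; zero; suc; toℕ; punchIn; splitAt; _≟_)
open import Data.Sum using (inj₁; inj₂)
open import Data.Integer as ℤ using (ℤ; +_; -_)
open import Data.List using (List; []; _∷_)
open import Data.Product using (Σ; _×_)
open import Function.Bundles using (_↔_; Inverse)
open import Relation.Nullary.Decidable using (⌊_⌋)
open import Relation.Binary.PropositionalEquality using (_≡_)

record Graph (n : ℕ) : Set where
  field
    adj : Fin n → Fin n → Bool
open Graph public

-- Isomorphism: a bijection of vertex sets preserving adjacency
-- (in both directions, since adjacency is Boolean-valued and preserved
-- as an equality of Booleans).
_≅_ : ∀ {m n} → Graph m → Graph n → Set
_≅_ {m} {n} G H =
  Σ (Fin m ↔ Fin n) λ σ →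
    ∀ u v → adj H (Inverse.to σ u) (Inverse.to σ v) ≡ adj G u v

-- The graph K_s^t on s + t vertices:
--   vertices 0 .. s-1 (the "left" part of splitAt s) form K_s,
--   vertex s + j (j < t) is a pendant vertex attached to clique vertex j.

eqFin : ∀ {n} → Fin n → Fin n → Bool
eqFin i j = ⌊ i ≟ j ⌋

eqℕ : ℕ → ℕ → Bool
eqℕ zero zero = true
eqℕ zero (suc _) = false
eqℕ (suc _) zero = false
eqℕ (suc m) (suc n) = eqℕ m n

notB : Bool → Bool
notB true = false
notB false = true

K : (s t : ℕ) → Graph (s + t)
adj (K s t) u v with splitAt s u | splitAt s v
... | inj₁ i | inj₁ j = notB (eqFin i j)
... | inj₁ i | inj₂ j = eqℕ (toℕ i) (toℕ j)
... | inj₂ i | inj₁ j = eqℕ (toℕ i) (toℕ j)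
... | inj₂ i | inj₂ j = false

anyFin : ∀ {n} → (Fin n → Bool) → Bool
anyFin {zero} f = false
anyFin {suc n} f = f zero ∨ anyFin (λ i → f (suc i))

reach : ∀ {n} → Graph n → ℕ → Fin n → Fin n → Bool
reach G zero u v = eqFin u v
reach G (suc k) u v = reach G k u v ∨ anyFin (λ w → reach G k u w ∧ adj G w v)

firstTrue : (ℕ → Bool) → ℕ → (fuel : ℕ) → ℕ
firstTrue p k zero = k
firstTrue p k (suc fuel) = if p k then k else firstTrue p (suc k) fuel

-- dist G u v = least k with a walk of length ≤ k from u to v, i.e. the
-- length of a shortest u–v path.  (For connected graphs on n vertices
-- this is always < n; the value n is only a default for unreachable pairs.)
dist : ∀ {n} → Graph n → Fin n → Fin n → ℕ
dist {n} G u v = firstTrue (λ k → reach G k u v) 0 n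

D : ∀ {n} → Graph n → Fin n → Fin n → ℤ
D G u v = + dist G u v

-- Integer polynomials as coefficient lists (constant term first).

Poly : Set
Poly = List ℤ

_+P_ : Poly → Poly → Poly
[] +P q = q
(a ∷ p) +P [] = a ∷ p
(a ∷ p) +P (b ∷ q) = (a ℤ.+ b) ∷ (p +P q)

scaleP : ℤ → Poly → Poly
scaleP c [] = []
scaleP c (a ∷ p) = (c ℤ.* a) ∷ scaleP c p

_*P_ : Poly → Poly → Poly
[] *P q = []
(a ∷ p) *P q = scaleP a q +P (+ 0 ∷ (p *P q))

negP : Poly → Poly
negP = scaleP (- (+ 1))

sgnP : ℕ → Poly → Poly
sgnP zero p = p
sgnP (suc k) p = negP (sgnP k p)

sumFin : ∀ {n} → (Fin n → Poly) → Poly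
sumFin {zero} f = []
sumFin {suc n} f = f zero +P sumFin (λ i → f (suc i))

det : ∀ n → (Fin n → Fin n → Poly) → Poly
det zero M = + 1 ∷ []
det (suc n) M =
  sumFin (λ j → sgnP (toℕ j) (M zero j *P det n (λ r c → M (suc r) (punchIn j c))))

coeff : Poly → ℕ → ℤ
coeff [] k = + 0
coeff (a ∷ p) zero = a
coeff (a ∷ p) (suc k) = coeff p k

charPoly : ∀ {n} → (Fin n → Fin n → ℤ) → Poly
charPoly {n} A = det n (λ i j → if eqFin i j then (- A i j) ∷ + 1 ∷ [] else (- A i j) ∷ [])

-- Two square integer matrices have the same spectrum (with multiplicities)
-- iff their characteristic polynomials coincide.
SameSpectrum : ∀ {m n} → (Fin m → Fin m → ℤ) → (Fin n → Fin n → ℤ) → Set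
SameSpectrum A B = ∀ k → coeff (charPoly A) k ≡ coeff (charPoly B) k

DCospectral : ∀ {m n} → Graph m → Graph n → Set
DCospectral G H = SameSpectrum (D G) (D H)

-- For a hollow matrix A (zero diagonal) the coefficient of x^(n-2) in det(x·I − A) is −½·tr(A²),
-- so D-cospectral graphs have the same sum of squared distances over ordered pairs of vertices.
-- In K_s^t two clique vertices are at distance 1, a clique vertex and a pendant vertex at
-- distance 1 or 2, and two pendant vertices at distance 3; hence tr(D²) = n² + 6nt + 2t² − n − 14t
-- with n = s + t.  For fixed n ≥ 3 this is injective in t, so t, and then s = n − t, are
-- determined by the spectrum.
module Submission where

open import Defs
open import Data.Bool using (Bool; true; false; if_then_else_; _∧_; _∨_)
open import Data.Bool.Properties using (∨-zeroʳ; ∨-identityʳ)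
open import Data.Empty using (⊥-elim)
open import Data.Fin using (Fin; zero; suc; toℕ; punchIn; splitAt; _↑ˡ_; _↑ʳ_; inject≤; _≟_)
open import Data.Fin.Properties
  using (suc-injective; punchIn-injective; punchInᵢ≢i; splitAt-↑ˡ; splitAt-↑ʳ; splitAt⁻¹-↑ˡ;
         splitAt⁻¹-↑ʳ; ↑ˡ-injective; ↑ʳ-injective; toℕ-injective; toℕ-inject≤; toℕ-↑ˡ; toℕ-↑ʳ; toℕ<n)
open import Data.Integer using (ℤ; +_; -_; _+_; _*_; _-_; 0ℤ; 1ℤ)
import Data.Integer.Properties as ℤP
open import Data.Integer.Tactic.RingSolver using (solve-∀)
open import Data.List using ([]; _∷_)
open import Data.Nat as ℕ using (ℕ; zero; suc; _<_; _≤_; z≤n; s≤s)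
import Data.Nat.Properties as ℕP
open import Data.Product using (∃-syntax; _,_)
open import Data.Sum using (inj₁; inj₂; [_,_]′)
open import Function using (_∘_)
open import Function.Definitions using (Injective)
open import Function.Properties.Inverse using (↔-refl)
open import Relation.Binary.PropositionalEquality
open import Relation.Nullary using (yes; no)
open import Relation.Nullary.Decidable using (dec-true; dec-false; isYes≗does)
open import Algebra.Properties.Semiring.Sum ℤP.+-*-semiring using (sum-syntax; sum-cong-≗; ∑-distrib-+)

open ≡-Reasoning

eqFin-refl : ∀ {n} (i : Fin n) → eqFin i i ≡ true
eqFin-refl i = trans (isYes≗does (i ≟ i)) (dec-true (i ≟ i) refl)

eqFin-≢ : ∀ {n} {i j : Fin n} → i ≢ j → eqFin i j ≡ false
eqFin-≢ {i = i} {j} i≢j = trans (isYes≗does (i ≟ j)) (dec-false (i ≟ j) i≢j)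

eqFin-injective : ∀ {m n} {f : Fin m → Fin n} → Injective _≡_ _≡_ f → ∀ i j → eqFin (f i) (f j) ≡ eqFin i j
eqFin-injective {f = f} inj i j with i ≟ j
... | yes refl = eqFin-refl (f i)
... | no i≢j   = eqFin-≢ (i≢j ∘ inj)

eqℕ-refl : ∀ m → eqℕ m m ≡ true
eqℕ-refl zero    = refl
eqℕ-refl (suc m) = eqℕ-refl m

eqℕ-complete : ∀ {m n} → m ≡ n → eqℕ m n ≡ true
eqℕ-complete {m} refl = eqℕ-refl m

eqℕ-sound : ∀ m n → eqℕ m n ≡ true → m ≡ n
eqℕ-sound zero    zero    _  = refl
eqℕ-sound (suc m) (suc n) eq = cong suc (eqℕ-sound m n eq)

eqℕ-≢ : ∀ {m n} → m ≢ n → eqℕ m n ≡ false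
eqℕ-≢ {zero}  {zero}  m≢n = ⊥-elim (m≢n refl)
eqℕ-≢ {zero}  {suc n} m≢n = refl
eqℕ-≢ {suc m} {zero}  m≢n = refl
eqℕ-≢ {suc m} {suc n} m≢n = eqℕ-≢ (m≢n ∘ cong suc)

eqℕ-toℕ : ∀ {n} (i j : Fin n) → eqℕ (toℕ i) (toℕ j) ≡ eqFin i j
eqℕ-toℕ i j with i ≟ j
... | yes refl = eqℕ-refl (toℕ i)
... | no i≢j   = eqℕ-≢ (i≢j ∘ toℕ-injective)

sum-zero : ∀ {n} (f : Fin n → ℤ) → (∀ i → f i ≡ 0ℤ) → ∑[ i < n ] f i ≡ 0ℤ
sum-zero {zero}  f f≡0 = refl
sum-zero {suc n} f f≡0 = cong₂ _+_ (f≡0 zero) (sum-zero (f ∘ suc) (f≡0 ∘ suc))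

sum-const : ∀ n c → ∑[ i < n ] c ≡ + n * c
sum-const zero    c = sym (ℤP.*-zeroˡ c)
sum-const (suc n) c = trans (cong (_+_ c) (sum-const n c)) (sym (ℤP.suc-* (+ n) c))

sum-neg : ∀ {n} (f : Fin n → ℤ) → ∑[ i < n ] (- f i) ≡ - ∑[ i < n ] f i
sum-neg {zero}  f = refl
sum-neg {suc n} f = trans (cong (_+_ (- f zero)) (sum-neg (f ∘ suc))) (sym (ℤP.neg-distrib-+ (f zero) _))

sum-++ : ∀ m n (f : Fin (m ℕ.+ n) → ℤ) →
         ∑[ k < m ℕ.+ n ] f k ≡ ∑[ i < m ] f (i ↑ˡ n) + ∑[ j < n ] f (m ↑ʳ j)
sum-++ zero    n f = sym (ℤP.+-identityˡ _)
sum-++ (suc m) n f = trans (cong (_+_ (f zero)) (sum-++ m n (f ∘ suc))) (sym (ℤP.+-assoc (f zero) _ _))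

sum-indicator : ∀ {n} (i : Fin (suc n)) a b → ∑[ j < suc n ] (if eqFin i j then a else b) ≡ a + + n * b
sum-indicator {n}     zero    a b = cong (_+_ a) (sum-const n b)
sum-indicator {suc n} (suc i) a b = begin
  b + ∑[ j < suc n ] (if eqFin (suc i) (suc j) then a else b)
    ≡⟨ cong (_+_ b) (sum-cong-≗ λ j → cong (if_then a else b) (eqFin-injective suc-injective i j)) ⟩
  b + ∑[ j < suc n ] (if eqFin i j then a else b)
    ≡⟨ cong (_+_ b) (sum-indicator i a b) ⟩
  b + (a + + n * b)
    ≡⟨ regroup a b (+ n) ⟩
  a + + suc n * b
    ∎
  where
  regroup : ∀ a b m → b + (a + m * b) ≡ a + (1ℤ + m) * b
  regroup = solve-∀

coeff-[] : ∀ k → coeff [] k ≡ 0ℤ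
coeff-[] zero    = refl
coeff-[] (suc k) = refl

coeff-+P : ∀ p q k → coeff (p +P q) k ≡ coeff p k + coeff q k
coeff-+P []      q       k       = sym (ℤP.+-identityˡ _)
coeff-+P (a ∷ p) []      k       = sym (trans (cong (_+_ (coeff (a ∷ p) k)) (coeff-[] k)) (ℤP.+-identityʳ _))
coeff-+P (a ∷ p) (b ∷ q) zero    = refl
coeff-+P (a ∷ p) (b ∷ q) (suc k) = coeff-+P p q k

coeff-scaleP : ∀ c p k → coeff (scaleP c p) k ≡ c * coeff p k
coeff-scaleP c []      k       = trans (coeff-[] k) (sym (trans (cong (c *_) (coeff-[] k)) (ℤP.*-zeroʳ c)))
coeff-scaleP c (a ∷ p) zero    = refl
coeff-scaleP c (a ∷ p) (suc k) = coeff-scaleP c p k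

coeff-sumFin : ∀ {n} (f : Fin n → Poly) k → coeff (sumFin f) k ≡ ∑[ j < n ] coeff (f j) k
coeff-sumFin {zero}  f k = coeff-[] k
coeff-sumFin {suc n} f k = trans (coeff-+P (f zero) _ k) (cong (_+_ (coeff (f zero) k)) (coeff-sumFin (f ∘ suc) k))

coeff-∷*P-zero : ∀ a p q → coeff ((a ∷ p) *P q) zero ≡ a * coeff q zero
coeff-∷*P-zero a p q = trans (coeff-+P (scaleP a q) _ zero) (trans (ℤP.+-identityʳ _) (coeff-scaleP a q zero))

coeff-∷*P-suc : ∀ a p q k → coeff ((a ∷ p) *P q) (suc k) ≡ a * coeff q (suc k) + coeff (p *P q) k
coeff-∷*P-suc a p q k = trans (coeff-+P (scaleP a q) _ (suc k)) (cong (_+ _) (coeff-scaleP a q (suc k)))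

coeff-const*P : ∀ a q k → coeff ((a ∷ []) *P q) k ≡ a * coeff q k
coeff-const*P a q zero    = coeff-∷*P-zero a [] q
coeff-const*P a q (suc k) = begin
  coeff ((a ∷ []) *P q) (suc k)     ≡⟨ coeff-∷*P-suc a [] q k ⟩
  a * coeff q (suc k) + coeff [] k  ≡⟨ cong (_+_ (a * coeff q (suc k))) (coeff-[] k) ⟩
  a * coeff q (suc k) + 0ℤ          ≡⟨ ℤP.+-identityʳ _ ⟩
  a * coeff q (suc k)               ∎

coeff-monicLinear*P : ∀ a q k → coeff ((a ∷ 1ℤ ∷ []) *P q) (suc k) ≡ a * coeff q (suc k) + coeff q k
coeff-monicLinear*P a q k = begin
  coeff ((a ∷ 1ℤ ∷ []) *P q) (suc k)              ≡⟨ coeff-∷*P-suc a (1ℤ ∷ []) q k ⟩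
  a * coeff q (suc k) + coeff ((1ℤ ∷ []) *P q) k  ≡⟨ cong (_+_ (a * coeff q (suc k))) (coeff-const*P 1ℤ q k) ⟩
  a * coeff q (suc k) + 1ℤ * coeff q k            ≡⟨ cong (_+_ (a * coeff q (suc k))) (ℤP.*-identityˡ _) ⟩
  a * coeff q (suc k) + coeff q k                 ∎

X : Poly
X = 0ℤ ∷ 1ℤ ∷ []

coeff-X*P-zero : ∀ q → coeff (X *P q) zero ≡ 0ℤ
coeff-X*P-zero q = coeff-∷*P-zero 0ℤ (1ℤ ∷ []) q

coeff-X*P-suc : ∀ q k → coeff (X *P q) (suc k) ≡ coeff q k
coeff-X*P-suc q k = trans (coeff-monicLinear*P 0ℤ q k) (ℤP.+-identityˡ (coeff q k))

sign : ℕ → ℤ → ℤ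
sign zero    x = x
sign (suc i) x = - sign i x

coeff-sgnP : ∀ i p k → coeff (sgnP i p) k ≡ sign i (coeff p k)
coeff-sgnP zero    p k = refl
coeff-sgnP (suc i) p k = begin
  coeff (negP (sgnP i p)) k   ≡⟨ coeff-scaleP (- 1ℤ) (sgnP i p) k ⟩
  - 1ℤ * coeff (sgnP i p) k   ≡⟨ ℤP.-1*i≡-i _ ⟩
  - coeff (sgnP i p) k        ≡⟨ cong -_ (coeff-sgnP i p k) ⟩
  - sign i (coeff p k)        ∎

sign-zero : ∀ i → sign i 0ℤ ≡ 0ℤ
sign-zero zero    = refl
sign-zero (suc i) = cong -_ (sign-zero i)

sign-neg : ∀ i x → sign i (- x) ≡ - sign i x
sign-neg zero    x = refl
sign-neg (suc i) x = cong -_ (sign-neg i x)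

sign-*ʳ : ∀ i a x → sign i (a * x) ≡ a * sign i x
sign-*ʳ zero    a x = refl
sign-*ʳ (suc i) a x = trans (cong -_ (sign-*ʳ i a x)) (ℤP.neg-distribʳ-* a (sign i x))

sign-involutive : ∀ i x → sign i (sign i x) ≡ x
sign-involutive zero    x = refl
sign-involutive (suc i) x = trans (cong -_ (sign-neg i (sign i x))) (trans (ℤP.neg-involutive _) (sign-involutive i x))

-- Determinants and degree bounds

minor : ∀ {n} {A : Set} → (Fin (suc n) → Fin (suc n) → A) → Fin (suc n) → Fin n → Fin n → A
minor M j r c = M (suc r) (punchIn j c)

sumFin-cong : ∀ {n} {f g : Fin n → Poly} → (∀ i → f i ≡ g i) → sumFin f ≡ sumFin g
sumFin-cong {zero}  f≗g = refl
sumFin-cong {suc n} f≗g = cong₂ _+P_ (f≗g zero) (sumFin-cong (f≗g ∘ suc))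

det-cong : ∀ n {M N : Fin n → Fin n → Poly} → (∀ r c → M r c ≡ N r c) → det n M ≡ det n N
det-cong zero    M≗N = refl
det-cong (suc n) M≗N = sumFin-cong λ j →
  cong (sgnP (toℕ j)) (cong₂ _*P_ (M≗N zero j) (det-cong n λ r c → M≗N (suc r) (punchIn j c)))

coeff-det-suc : ∀ n (M : Fin (suc n) → Fin (suc n) → Poly) k →
  coeff (det (suc n) M) k ≡ ∑[ j < suc n ] sign (toℕ j) (coeff (M zero j *P det n (minor M j)) k)
coeff-det-suc n M k =
  trans (coeff-sumFin (λ j → sgnP (toℕ j) (term j)) k) (sum-cong-≗ λ j → coeff-sgnP (toℕ j) (term j) k)
  where
  term : Fin (suc n) → Poly
  term j = M zero j *P det n (minor M j)

-- A record, so that d and p can be recovered by unification.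
record DegreeAtMost (d : ℕ) (p : Poly) : Set where
  constructor degree≤
  field
    coeff-above : ∀ k → d < k → coeff p k ≡ 0ℤ
open DegreeAtMost

data Affine : Poly → Set where
  constant : ∀ a → Affine (a ∷ [])
  linear   : ∀ a b → Affine (a ∷ b ∷ [])

IsConstant : Poly → Set
IsConstant p = ∃[ a ] p ≡ a ∷ []

degree-suc : ∀ {d p} → DegreeAtMost d p → DegreeAtMost (suc d) p
degree-suc deg = degree≤ λ k d<k → coeff-above deg k (ℕP.<-trans (ℕP.n<1+n _) d<k)

degree-constant*P : ∀ {d e q} → IsConstant e → DegreeAtMost d q → DegreeAtMost d (e *P q)
degree-constant*P {q = q} (a , refl) deg = degree≤ λ k d<k →
  trans (coeff-const*P a q k) (trans (cong (a *_) (coeff-above deg k d<k)) (ℤP.*-zeroʳ a))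

degree-affine*P : ∀ {d e q} → Affine e → DegreeAtMost d q → DegreeAtMost (suc d) (e *P q)
degree-affine*P (constant a) deg = degree-constant*P (a , refl) (degree-suc deg)
degree-affine*P {q = q} (linear a b) deg = degree≤ λ where
  (suc k) (s≤s d<k) → begin
    coeff ((a ∷ b ∷ []) *P q) (suc k)              ≡⟨ coeff-∷*P-suc a (b ∷ []) q k ⟩
    a * coeff q (suc k) + coeff ((b ∷ []) *P q) k  ≡⟨ cong₂ (λ x y → a * x + y)
                                                        (coeff-above (degree-suc deg) (suc k) (s≤s d<k))
                                                        (coeff-above (degree-constant*P (b , refl) deg) k d<k) ⟩
    a * 0ℤ + 0ℤ                                    ≡⟨ cong (_+ 0ℤ) (ℤP.*-zeroʳ a) ⟩
    0ℤ                                             ∎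

degree-det-suc : ∀ {d} n (M : Fin (suc n) → Fin (suc n) → Poly) →
  (∀ j → DegreeAtMost d (M zero j *P det n (minor M j))) → DegreeAtMost d (det (suc n) M)
degree-det-suc n M deg = degree≤ λ k d<k → trans (coeff-det-suc n M k)
  (sum-zero _ λ j → trans (cong (sign (toℕ j)) (coeff-above (deg j) k d<k)) (sign-zero (toℕ j)))

degree-det : ∀ n (M : Fin n → Fin n → Poly) → (∀ r c → Affine (M r c)) → DegreeAtMost n (det n M)
degree-det zero    M aff = degree≤ λ where (suc k) _ → coeff-[] k
degree-det (suc n) M aff = degree-det-suc n M λ j →
  degree-affine*P (aff zero j) (degree-det n (minor M j) λ r c → aff (suc r) (punchIn j c))

degree-det-constantRow : ∀ m (M : Fin (suc m) → Fin (suc m) → Poly) → (∀ r c → Affine (M r c)) →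
  (ρ : Fin (suc m)) → (∀ c → IsConstant (M ρ c)) → DegreeAtMost m (det (suc m) M)
degree-det-constantRow m M aff zero const = degree-det-suc m M λ j →
  degree-constant*P (const j) (degree-det m (minor M j) λ r c → aff (suc r) (punchIn j c))
degree-det-constantRow (suc m) M aff (suc ρ) const = degree-det-suc (suc m) M λ j →
  degree-affine*P (aff zero j)
    (degree-det-constantRow m (minor M j) (λ r c → aff (suc r) (punchIn j c)) ρ (λ c → const (punchIn j c)))

Matrix : ℕ → Set
Matrix n = Fin n → Fin n → ℤ

reindex : ∀ {m n} → (Fin m → Fin n) → Matrix n → Matrix m
reindex f A r c = A (f r) (f c)

-- charPoly A is definitionally det n (charEntry A).
charEntry : ∀ {n} → Matrix n → Fin n → Fin n → Poly
charEntry A i j = if eqFin i j then (- A i j) ∷ 1ℤ ∷ [] else (- A i j) ∷ []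

charSubmatrix : ∀ {m n} → Matrix n → (ρ κ : Fin m → Fin n) → Fin m → Fin m → Poly
charSubmatrix A ρ κ r c = charEntry A (ρ r) (κ c)

charSubmatrix-affine : ∀ {m n} (A : Matrix n) (ρ κ : Fin m → Fin n) r c → Affine (charSubmatrix A ρ κ r c)
charSubmatrix-affine A ρ κ r c with eqFin (ρ r) (κ c)
... | true  = linear _ _
... | false = constant _

charSubmatrix-constant : ∀ {m n} (A : Matrix n) (ρ κ : Fin m → Fin n) {r c} → ρ r ≢ κ c →
                         IsConstant (charSubmatrix A ρ κ r c)
charSubmatrix-constant A ρ κ ρr≢κc rewrite eqFin-≢ ρr≢κc = _ , refl

charSubmatrix-reindex : ∀ {l m n} (A : Matrix n) {f : Fin m → Fin n} → Injective _≡_ _≡_ f →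
  (ρ κ : Fin l → Fin m) → ∀ r c →
  charSubmatrix (reindex f A) ρ κ r c ≡ charSubmatrix A (f ∘ ρ) (f ∘ κ) r c
charSubmatrix-reindex A inj ρ κ r c rewrite eqFin-injective inj (ρ r) (κ c) = refl

degree-charSubmatrix : ∀ m {n} (A : Matrix n) (ρ κ : Fin (suc m) → Fin n) →
  (r : Fin (suc m)) → (∀ c → ρ r ≢ κ c) → DegreeAtMost m (det (suc m) (charSubmatrix A ρ κ))
degree-charSubmatrix m A ρ κ r missing =
  degree-det-constantRow m _ (charSubmatrix-affine A ρ κ) r λ c → charSubmatrix-constant A ρ κ (missing c)

charPoly-reindex : ∀ {m n} (A : Matrix n) {f : Fin m → Fin n} → Injective _≡_ _≡_ f →
                   charPoly (reindex f A) ≡ det m (charSubmatrix A f f)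
charPoly-reindex {m} A inj = det-cong m (charSubmatrix-reindex A inj (λ r → r) (λ c → c))

charPoly-expand : ∀ n (A : Matrix (suc n)) k →
  coeff (charPoly A) k ≡ coeff ((- A zero zero ∷ 1ℤ ∷ []) *P det n (charSubmatrix A suc suc)) k
    + ∑[ j < n ] (A zero (suc j) * sign (toℕ j) (coeff (det n (charSubmatrix A suc (punchIn (suc j)))) k))
charPoly-expand n A k = trans (coeff-det-suc n (charEntry A) k) (cong (_+_ diagonal-term) (sum-cong-≗ off-diagonal-term))
  where
  diagonal-term : ℤ
  diagonal-term = coeff ((- A zero zero ∷ 1ℤ ∷ []) *P det n (charSubmatrix A suc suc)) k
  off-diagonal-term : ∀ j →
    sign (suc (toℕ j)) (coeff ((- A zero (suc j) ∷ []) *P det n (charSubmatrix A suc (punchIn (suc j)))) k)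
      ≡ A zero (suc j) * sign (toℕ j) (coeff (det n (charSubmatrix A suc (punchIn (suc j)))) k)
  off-diagonal-term j = begin
    - sign (toℕ j) (coeff ((- a ∷ []) *P q) k)  ≡⟨ cong (λ x → - sign (toℕ j) x) (coeff-const*P (- a) q k) ⟩
    - sign (toℕ j) (- a * coeff q k)            ≡⟨ cong -_ (sign-*ʳ (toℕ j) (- a) (coeff q k)) ⟩
    - (- a * sign (toℕ j) (coeff q k))          ≡⟨ ℤP.neg-distribˡ-* (- a) _ ⟩
    - - a * sign (toℕ j) (coeff q k)            ≡⟨ cong (_* sign (toℕ j) (coeff q k)) (ℤP.neg-involutive a) ⟩
    a * sign (toℕ j) (coeff q k)                ∎
    where
    a = A zero (suc j)
    q = det n (charSubmatrix A suc (punchIn (suc j)))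

charPoly-monic : ∀ n (A : Matrix n) → coeff (charPoly A) n ≡ 1ℤ
charPoly-monic zero    A = refl
charPoly-monic (suc n) A = begin
  coeff (charPoly A) (suc n)
    ≡⟨ charPoly-expand n A (suc n) ⟩
  coeff ((- a ∷ 1ℤ ∷ []) *P Q) (suc n) + ∑[ j < n ] term j
    ≡⟨ cong₂ _+_ (coeff-monicLinear*P (- a) Q n) (sum-zero term term-vanishes) ⟩
  - a * coeff Q (suc n) + coeff Q n + 0ℤ
    ≡⟨ cong₂ (λ x y → - a * x + y + 0ℤ)
             (coeff-above (degree-det n _ (charSubmatrix-affine A suc suc)) (suc n) (ℕP.n<1+n n))
             (trans (cong (λ p → coeff p n) (sym (charPoly-reindex A suc-injective)))
                    (charPoly-monic n (reindex suc A))) ⟩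
  - a * 0ℤ + 1ℤ + 0ℤ
    ≡⟨ cong (λ x → x + 1ℤ + 0ℤ) (ℤP.*-zeroʳ (- a)) ⟩
  1ℤ
    ∎
  where
  a = A zero zero
  Q = det n (charSubmatrix A suc suc)
  term : Fin n → ℤ
  term j = A zero (suc j) * sign (toℕ j) (coeff (det n (charSubmatrix A suc (punchIn (suc j)))) (suc n))
  term-vanishes : ∀ j → term j ≡ 0ℤ
  term-vanishes j = begin
    term j                              ≡⟨ cong (λ x → A zero (suc j) * sign (toℕ j) x)
                                                (coeff-above (degree-det n _ (charSubmatrix-affine A suc (punchIn (suc j))))
                                                             (suc n) (ℕP.n<1+n n)) ⟩
    A zero (suc j) * sign (toℕ j) 0ℤ    ≡⟨ cong (A zero (suc j) *_) (sign-zero (toℕ j)) ⟩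
    A zero (suc j) * 0ℤ                 ≡⟨ ℤP.*-zeroʳ (A zero (suc j)) ⟩
    0ℤ                                  ∎

laplaceTerm-vanishes : ∀ m {n} (A : Matrix n) (ρ κ : Fin (suc (suc m)) → Fin n) (c : Fin (suc (suc m))) →
  ρ zero ≢ κ c → (r : Fin (suc m)) → (∀ c′ → ρ (suc r) ≢ κ (punchIn c c′)) →
  sign (toℕ c)
       (coeff (charSubmatrix A ρ κ zero c *P det (suc m) (charSubmatrix A (ρ ∘ suc) (κ ∘ punchIn c))) (suc m))
    ≡ 0ℤ
laplaceTerm-vanishes m A ρ κ c entry≢ r row-missing = trans
  (cong (sign (toℕ c)) (coeff-above (degree-constant*P (charSubmatrix-constant A ρ κ entry≢)
                                       (degree-charSubmatrix m A (ρ ∘ suc) (κ ∘ punchIn c) r row-missing))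
                                    (suc m) (ℕP.n<1+n m)))
  (sign-zero (toℕ c))

punchIn-punchIn : ∀ {m} (j c : Fin (suc m)) →
                  punchIn (suc zero) (punchIn (suc j) c) ≡ punchIn (suc (suc j)) (punchIn (suc zero) c)
punchIn-punchIn j zero    = refl
punchIn-punchIn j (suc c) = refl

-- Row j of this minor (row j + 1 of x·I − A) has lost its x, so up to sign its coefficient of x^m
-- is −A (j + 1) 0 times the complementary principal minor, which is monic.
coeff-det-firstRowMinor : ∀ m (A : Matrix (suc (suc m))) (j : Fin (suc m)) →
  coeff (det (suc m) (charSubmatrix A suc (punchIn (suc j)))) m ≡ sign (toℕ j) (- A (suc j) zero)
coeff-det-firstRowMinor m A zero = begin
  coeff (det (suc m) M) m                          ≡⟨ coeff-det-suc m M m ⟩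
  coeff ((- a ∷ []) *P Q) m + ∑[ c < m ] term c    ≡⟨ cong₂ _+_ (coeff-const*P (- a) Q m) (rest-vanishes m A) ⟩
  - a * coeff Q m + 0ℤ                             ≡⟨ cong (λ x → - a * x + 0ℤ) Q-monic ⟩
  - a * 1ℤ + 0ℤ                                    ≡⟨ trans (ℤP.+-identityʳ _) (ℤP.*-identityʳ _) ⟩
  - a                                              ∎
  where
  a = A (suc zero) zero
  M : Fin (suc m) → Fin (suc m) → Poly
  M = charSubmatrix A suc (punchIn (suc zero))
  Q : Poly
  Q = det m (charSubmatrix A (λ i → suc (suc i)) (λ i → suc (suc i)))
  term : Fin m → ℤ
  term c = sign (suc (toℕ c)) (coeff (M zero (suc c) *P det m (minor M (suc c))) m)
  Q-monic : coeff Q m ≡ 1ℤ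
  Q-monic = trans (cong (λ p → coeff p m) (sym (charPoly-reindex A (λ eq → suc-injective (suc-injective eq)))))
                  (charPoly-monic m (reindex (λ i → suc (suc i)) A))
  rest-vanishes : ∀ m′ (B : Matrix (suc (suc m′))) →
    ∑[ c < m′ ] sign (suc (toℕ c)) (coeff (charSubmatrix B suc (punchIn (suc zero)) zero (suc c)
                                            *P det m′ (minor (charSubmatrix B suc (punchIn (suc zero))) (suc c))) m′)
      ≡ 0ℤ
  rest-vanishes zero     B = refl
  rest-vanishes (suc m′) B = sum-zero _ λ c →
    laplaceTerm-vanishes m′ B suc (punchIn (suc zero)) (suc c) (λ ()) c λ c′ eq →
      punchInᵢ≢i (suc c) c′ (sym (punchIn-injective (suc zero) (suc c) (punchIn (suc c) c′) eq))
coeff-det-firstRowMinor (suc m) A (suc j) = begin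
  coeff (det (suc (suc m)) M) (suc m)
    ≡⟨ coeff-det-suc (suc m) M (suc m) ⟩
  term zero + (term (suc zero) + ∑[ c < m ] term (suc (suc c)))
    ≡⟨ cong₂ (λ x y → x + (term (suc zero) + y))
             (laplaceTerm-vanishes m A suc κ zero (λ ()) j (row-missing zero))
             (sum-zero _ λ c → laplaceTerm-vanishes m A suc κ (suc (suc c)) (λ ()) j (row-missing (suc (suc c)))) ⟩
  0ℤ + (- coeff ((- a ∷ 1ℤ ∷ []) *P Q) (suc m) + 0ℤ)
    ≡⟨ cong (λ x → 0ℤ + (- x + 0ℤ)) (coeff-monicLinear*P (- a) Q m) ⟩
  0ℤ + (- (- a * coeff Q (suc m) + coeff Q m) + 0ℤ)
    ≡⟨ cong₂ (λ x y → 0ℤ + (- (- a * x + y) + 0ℤ))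
             (coeff-above (degree-charSubmatrix m A (λ i → suc (suc i)) (κ ∘ punchIn (suc zero))
                                                j (row-missing (suc zero)))
                          (suc m) (ℕP.n<1+n m))
             (trans (cong (λ p → coeff p m) (det-cong (suc m) Q-reindexed)) (coeff-det-firstRowMinor m A′ j)) ⟩
  0ℤ + (- (- a * 0ℤ + sign (toℕ j) (- A (suc (suc j)) zero)) + 0ℤ)
    ≡⟨ simplify (- a) (sign (toℕ j) (- A (suc (suc j)) zero)) ⟩
  - sign (toℕ j) (- A (suc (suc j)) zero)
    ∎
  where
  a = A (suc zero) (suc zero)
  κ : Fin (suc (suc m)) → Fin (suc (suc (suc m)))
  κ = punchIn (suc (suc j))
  M : Fin (suc (suc m)) → Fin (suc (suc m)) → Poly
  M = charSubmatrix A suc κ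
  Q : Poly
  Q = det (suc m) (charSubmatrix A (λ i → suc (suc i)) (κ ∘ punchIn (suc zero)))
  A′ : Matrix (suc (suc m))
  A′ = reindex (punchIn (suc zero)) A
  term : Fin (suc (suc m)) → ℤ
  term c = sign (toℕ c) (coeff (M zero c *P det (suc m) (minor M c)) (suc m))
  row-missing : ∀ c c′ → suc (suc j) ≢ κ (punchIn c c′)
  row-missing c c′ = punchInᵢ≢i (suc (suc j)) (punchIn c c′) ∘ sym
  Q-reindexed : ∀ r c → charSubmatrix A (λ i → suc (suc i)) (κ ∘ punchIn (suc zero)) r c
                      ≡ charSubmatrix A′ suc (punchIn (suc j)) r c
  Q-reindexed r c = trans (cong (charEntry A (suc (suc r))) (sym (punchIn-punchIn j c)))
                          (sym (charSubmatrix-reindex A (punchIn-injective (suc zero) _ _) suc (punchIn (suc j)) r c))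
  simplify : ∀ a s → 0ℤ + (- (a * 0ℤ + s) + 0ℤ) ≡ - s
  simplify = solve-∀

-- Hollow matrices

Hollow : ∀ {n} → Matrix n → Set
Hollow A = ∀ i → A i i ≡ 0ℤ

traceSq : ∀ {n} → Matrix n → ℤ
traceSq {n} A = ∑[ i < n ] ∑[ j < n ] (A i j * A j i)

row₀·col₀ : ∀ {n} → Matrix (suc n) → ℤ
row₀·col₀ {n} A = ∑[ j < n ] (A zero (suc j) * A (suc j) zero)

traceSq-suc : ∀ {n} (A : Matrix (suc n)) → Hollow A →
              traceSq A ≡ row₀·col₀ A + row₀·col₀ A + traceSq (reindex suc A)
traceSq-suc {n} A hollow = begin
  (A zero zero * A zero zero + S) + ∑[ i < n ] (A (suc i) zero * A zero (suc i) + ∑[ j < n ] (A′ i j * A′ j i))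
    ≡⟨ cong₂ (λ x y → (x * x + S) + y) (hollow zero)
             (∑-distrib-+ (λ i → A (suc i) zero * A zero (suc i)) (λ i → ∑[ j < n ] (A′ i j * A′ j i))) ⟩
  (0ℤ * 0ℤ + S) + (∑[ i < n ] (A (suc i) zero * A zero (suc i)) + traceSq A′)
    ≡⟨ cong (λ x → (0ℤ * 0ℤ + S) + (x + traceSq A′))
            (sum-cong-≗ λ i → ℤP.*-comm (A (suc i) zero) (A zero (suc i))) ⟩
  (0ℤ * 0ℤ + S) + (S + traceSq A′)
    ≡⟨ regroup S (traceSq A′) ⟩
  S + S + traceSq A′
    ∎
  where
  S = row₀·col₀ A
  A′ = reindex suc A
  regroup : ∀ s t → (0ℤ * 0ℤ + s) + (s + t) ≡ s + s + t
  regroup = solve-∀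

coeff-charPoly-hollow-step : ∀ m (A : Matrix (suc (suc m))) → Hollow A →
  coeff (charPoly A) m ≡ coeff (X *P charPoly (reindex suc A)) m - row₀·col₀ A
coeff-charPoly-hollow-step m A hollow = begin
  coeff (charPoly A) m
    ≡⟨ charPoly-expand (suc m) A m ⟩
  coeff ((- A zero zero ∷ 1ℤ ∷ []) *P Q) m + ∑[ j < suc m ] term j
    ≡⟨ cong₂ (λ a q → coeff ((- a ∷ 1ℤ ∷ []) *P q) m + ∑[ j < suc m ] term j)
             (hollow zero) (sym (charPoly-reindex A suc-injective)) ⟩
  coeff (X *P charPoly (reindex suc A)) m + ∑[ j < suc m ] term j
    ≡⟨ cong (_+_ (coeff (X *P charPoly (reindex suc A)) m))
            (trans (sum-cong-≗ term≡) (sum-neg (λ j → A zero (suc j) * A (suc j) zero))) ⟩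
  coeff (X *P charPoly (reindex suc A)) m - row₀·col₀ A
    ∎
  where
  Q : Poly
  Q = det (suc m) (charSubmatrix A suc suc)
  term : Fin (suc m) → ℤ
  term j = A zero (suc j) * sign (toℕ j) (coeff (det (suc m) (charSubmatrix A suc (punchIn (suc j)))) m)
  term≡ : ∀ j → term j ≡ - (A zero (suc j) * A (suc j) zero)
  term≡ j = begin
    term j                                                         ≡⟨ cong (λ x → A zero (suc j) * sign (toℕ j) x)
                                                                           (coeff-det-firstRowMinor m A j) ⟩
    A zero (suc j) * sign (toℕ j) (sign (toℕ j) (- A (suc j) zero)) ≡⟨ cong (A zero (suc j) *_)
                                                                           (sign-involutive (toℕ j) _) ⟩
    A zero (suc j) * - A (suc j) zero                              ≡⟨ ℤP.neg-distribʳ-* (A zero (suc j)) _ ⟨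
    - (A zero (suc j) * A (suc j) zero)                            ∎

coeff-charPoly-hollow : ∀ m (A : Matrix (suc (suc m))) → Hollow A →
                        coeff (charPoly A) m + coeff (charPoly A) m ≡ - traceSq A
coeff-charPoly-hollow zero A hollow = begin
  c + c                                ≡⟨ cong₂ _+_ c≡ c≡ ⟩
  (0ℤ - S) + (0ℤ - S)                  ≡⟨ regroup S ⟩
  - (S + S + 0ℤ)                       ≡⟨ cong (λ t → - (S + S + t))
                                               (traceSq-suc (reindex suc A) (hollow ∘ suc)) ⟨
  - (S + S + traceSq (reindex suc A))  ≡⟨ cong -_ (traceSq-suc A hollow) ⟨
  - traceSq A                          ∎
  where
  c = coeff (charPoly A) zero
  S = row₀·col₀ A
  c≡ : c ≡ 0ℤ - S
  c≡ = trans (coeff-charPoly-hollow-step zero A hollow) (cong (_- S) (coeff-X*P-zero (charPoly (reindex suc A))))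
  regroup : ∀ s → (0ℤ - s) + (0ℤ - s) ≡ - (s + s + 0ℤ)
  regroup = solve-∀
coeff-charPoly-hollow (suc m) A hollow = begin
  c + c                                ≡⟨ cong₂ _+_ c≡ c≡ ⟩
  (c′ - S) + (c′ - S)                  ≡⟨ regroup c′ S ⟩
  (c′ + c′) - (S + S)                  ≡⟨ cong (_- (S + S))
                                               (coeff-charPoly-hollow m (reindex suc A) (hollow ∘ suc)) ⟩
  - traceSq (reindex suc A) - (S + S)  ≡⟨ regroup′ S (traceSq (reindex suc A)) ⟩
  - (S + S + traceSq (reindex suc A))  ≡⟨ cong -_ (traceSq-suc A hollow) ⟨
  - traceSq A                          ∎
  where
  c = coeff (charPoly A) (suc m)
  c′ = coeff (charPoly (reindex suc A)) m
  S = row₀·col₀ A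
  c≡ : c ≡ c′ - S
  c≡ = trans (coeff-charPoly-hollow-step (suc m) A hollow) (cong (_- S) (coeff-X*P-suc (charPoly (reindex suc A)) m))
  regroup : ∀ c s → (c - s) + (c - s) ≡ (c + c) - (s + s)
  regroup = solve-∀
  regroup′ : ∀ s t → - t - (s + s) ≡ - (s + s + t)
  regroup′ = solve-∀

cospectral⇒traceSq≡ : ∀ {m n} (A : Matrix m) (B : Matrix n) → m ≡ n → Hollow A → Hollow B →
                      SameSpectrum A B → traceSq A ≡ traceSq B
cospectral⇒traceSq≡ {zero}        A B refl hollowA hollowB same = refl
cospectral⇒traceSq≡ {suc zero}    A B refl hollowA hollowB same =
  trans (traceSq-suc A hollowA) (sym (traceSq-suc B hollowB))
cospectral⇒traceSq≡ {suc (suc m)} A B refl hollowA hollowB same = ℤP.neg-injective (begin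
  - traceSq A                                  ≡⟨ coeff-charPoly-hollow m A hollowA ⟨
  coeff (charPoly A) m + coeff (charPoly A) m  ≡⟨ cong₂ _+_ (same m) (same m) ⟩
  coeff (charPoly B) m + coeff (charPoly B) m  ≡⟨ coeff-charPoly-hollow m B hollowB ⟩
  - traceSq B                                  ∎)

-- Shortest-path distances

anyFin-true : ∀ {n} (f : Fin n → Bool) w → f w ≡ true → anyFin f ≡ true
anyFin-true f zero    fw≡true rewrite fw≡true = refl
anyFin-true f (suc w) fw≡true = trans (cong (f zero ∨_) (anyFin-true (f ∘ suc) w fw≡true)) (∨-zeroʳ (f zero))

anyFin-false : ∀ {n} (f : Fin n → Bool) → (∀ w → f w ≡ false) → anyFin f ≡ false
anyFin-false {zero}  f f≡false = refl
anyFin-false {suc n} f f≡false = cong₂ _∨_ (f≡false zero) (anyFin-false (f ∘ suc) (f≡false ∘ suc))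

anyFin-cong : ∀ {n} {f g : Fin n → Bool} → (∀ w → f w ≡ g w) → anyFin f ≡ anyFin g
anyFin-cong {zero}  f≗g = refl
anyFin-cong {suc n} f≗g = cong₂ _∨_ (f≗g zero) (anyFin-cong (f≗g ∘ suc))

anyFin-eqFin : ∀ {n} (u : Fin n) (g : Fin n → Bool) → anyFin (λ w → eqFin u w ∧ g w) ≡ g u
anyFin-eqFin zero    g =
  trans (cong (g zero ∨_) (anyFin-false (λ w → eqFin zero (suc w) ∧ g (suc w)) λ _ → refl))
        (∨-identityʳ (g zero))
anyFin-eqFin (suc u) g = trans
  (anyFin-cong λ w → cong (_∧ g (suc w)) (eqFin-injective suc-injective u w))
  (anyFin-eqFin u (g ∘ suc))

module _ {n} (G : Graph n) where
  reach-one : ∀ u v → reach G 1 u v ≡ eqFin u v ∨ adj G u v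
  reach-one u v = cong (eqFin u v ∨_) (anyFin-eqFin u λ w → adj G w v)

  reach-step : ∀ k u w v → reach G k u w ≡ true → adj G w v ≡ true → reach G (suc k) u v ≡ true
  reach-step k u w v uw vw = trans
    (cong (reach G k u v ∨_) (anyFin-true (λ w′ → reach G k u w′ ∧ adj G w′ v) w (cong₂ _∧_ uw vw)))
    (∨-zeroʳ (reach G k u v))

  reach-adj : ∀ u v → adj G u v ≡ true → reach G 1 u v ≡ true
  reach-adj u v = reach-step 0 u u v (eqFin-refl u)

  reach-one-false : ∀ {u v} → u ≢ v → adj G u v ≡ false → reach G 1 u v ≡ false
  reach-one-false {u} {v} u≢v uv = trans (reach-one u v) (cong₂ _∨_ (eqFin-≢ u≢v) uv)

  reach-suc-false : ∀ k u v → reach G k u v ≡ false → (∀ w → reach G k u w ≡ true → adj G w v ≡ false) →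
                    reach G (suc k) u v ≡ false
  reach-suc-false k u v uv no-last-step = cong₂ _∨_ uv (anyFin-false _ last-step)
    where
    last-step : ∀ w → reach G k u w ∧ adj G w v ≡ false
    last-step w with reach G k u w in uw
    ... | true  = no-last-step w uw
    ... | false = refl

  reach-antitone : ∀ k d u v → k ≤ d → reach G d u v ≡ false → reach G k u v ≡ false
  reach-antitone k d u v k≤d ud with ℕP.m≤n⇒m<n∨m≡n k≤d
  ... | inj₂ refl = ud
  reach-antitone k (suc d) u v _ ud | inj₁ (s≤s k≤d) with reach G d u v in ud′
  ... | false = reach-antitone k d u v k≤d ud′

firstTrue-least : ∀ (p : ℕ → Bool) d → p d ≡ true → (∀ k → k < d → p k ≡ false) →
                  ∀ k fuel → k ≤ d → d < k ℕ.+ fuel → firstTrue p k fuel ≡ d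
firstTrue-least p d pd below k zero    k≤d d<k+0 =
  ⊥-elim (ℕP.<-irrefl refl (ℕP.<-≤-trans d<k+0 (ℕP.≤-trans (ℕP.≤-reflexive (ℕP.+-identityʳ k)) k≤d)))
firstTrue-least p d pd below k (suc fuel) k≤d d<k+fuel with ℕP.m≤n⇒m<n∨m≡n k≤d
... | inj₂ refl rewrite pd = refl
... | inj₁ k<d  rewrite below k k<d =
  firstTrue-least p d pd below (suc k) fuel k<d (subst (d <_) (ℕP.+-suc k fuel) d<k+fuel)

dist-self : ∀ {n} (G : Graph n) u → dist G u u ≡ 0
dist-self {suc n} G u = firstTrue-least _ 0 (eqFin-refl u) (λ _ ()) 0 (suc n) z≤n (s≤s z≤n)

dist-suc : ∀ {n} (G : Graph n) u v d → reach G (suc d) u v ≡ true → reach G d u v ≡ false → suc d < n →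
           dist G u v ≡ suc d
dist-suc {n} G u v d reached unreached d<n = firstTrue-least _ (suc d) reached
  (λ k k<d → reach-antitone G k d u v (ℕP.≤-pred k<d) unreached) 0 n z≤n d<n

D-hollow : ∀ {n} (G : Graph n) → Hollow (D G)
D-hollow G u = cong +_ (dist-self G u)

module K-graph (s t : ℕ) where
  clique : Fin s → Fin (s ℕ.+ t)
  clique i = i ↑ˡ t

  pendant : Fin t → Fin (s ℕ.+ t)
  pendant j = s ↑ʳ j

  vertex-cases : (P : Fin (s ℕ.+ t) → Set) → (∀ i → P (clique i)) → (∀ j → P (pendant j)) → ∀ v → P v
  vertex-cases P P-clique P-pendant v with splitAt s v in split≡
  ... | inj₁ i = subst P (splitAt⁻¹-↑ˡ split≡) (P-clique i)
  ... | inj₂ j = subst P (splitAt⁻¹-↑ʳ split≡) (P-pendant j)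

  clique≢pendant : ∀ i j → clique i ≢ pendant j
  clique≢pendant i j eq with trans (sym (splitAt-↑ˡ s i t)) (trans (cong (splitAt s) eq) (splitAt-↑ʳ s t j))
  ... | ()

  adj-clique-clique : ∀ i i′ → adj (K s t) (clique i) (clique i′) ≡ notB (eqFin i i′)
  adj-clique-clique i i′ rewrite splitAt-↑ˡ s i t | splitAt-↑ˡ s i′ t = refl

  adj-clique-pendant : ∀ i j → adj (K s t) (clique i) (pendant j) ≡ eqℕ (toℕ i) (toℕ j)
  adj-clique-pendant i j rewrite splitAt-↑ˡ s i t | splitAt-↑ʳ s t j = refl

  adj-pendant-clique : ∀ j i → adj (K s t) (pendant j) (clique i) ≡ eqℕ (toℕ j) (toℕ i)
  adj-pendant-clique j i rewrite splitAt-↑ʳ s t j | splitAt-↑ˡ s i t = refl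

  adj-pendant-pendant : ∀ j j′ → adj (K s t) (pendant j) (pendant j′) ≡ false
  adj-pendant-pendant j j′ rewrite splitAt-↑ʳ s t j | splitAt-↑ʳ s t j′ = refl

  module Distances (t≤s : t ≤ s) (3<n : 3 < s ℕ.+ t) where
    private
      G = K s t
      2<n = ℕP.<-trans (ℕP.n<1+n 2) 3<n
      1<n = ℕP.<-trans (ℕP.n<1+n 1) 2<n

    partner : Fin t → Fin s
    partner j = inject≤ j t≤s

    toℕ-partner : ∀ j → toℕ (partner j) ≡ toℕ j
    toℕ-partner j = toℕ-inject≤ j t≤s

    clique-adj-clique : ∀ {i i′} → i ≢ i′ → adj G (clique i) (clique i′) ≡ true
    clique-adj-clique {i} {i′} i≢i′ = trans (adj-clique-clique i i′) (cong notB (eqFin-≢ i≢i′))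

    clique-adj-pendant : ∀ {i j} → toℕ i ≡ toℕ j → adj G (clique i) (pendant j) ≡ true
    clique-adj-pendant {i} {j} i≡j = trans (adj-clique-pendant i j) (eqℕ-complete i≡j)

    pendant-adj-clique : ∀ {i j} → toℕ i ≡ toℕ j → adj G (pendant j) (clique i) ≡ true
    pendant-adj-clique {i} {j} i≡j = trans (adj-pendant-clique j i) (eqℕ-complete (sym i≡j))

    ≢-partner : ∀ {i j} → toℕ i ≢ toℕ j → i ≢ partner j
    ≢-partner {j = j} i≢j i≡pj = i≢j (trans (cong toℕ i≡pj) (toℕ-partner j))

    reach-pendant-clique : ∀ {i j} → toℕ i ≢ toℕ j → reach G 2 (pendant j) (clique i) ≡ true
    reach-pendant-clique {i} {j} i≢j = reach-step G 1 (pendant j) (clique (partner j)) (clique i)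
      (reach-adj G _ _ (pendant-adj-clique (toℕ-partner j)))
      (clique-adj-clique (≢-partner i≢j ∘ sym))

    dist-clique-clique : ∀ {i i′} → i ≢ i′ → dist G (clique i) (clique i′) ≡ 1
    dist-clique-clique {i} {i′} i≢i′ = dist-suc G _ _ 0 (reach-adj G _ _ (clique-adj-clique i≢i′))
      (eqFin-≢ (i≢i′ ∘ ↑ˡ-injective t i i′)) 1<n

    dist-clique-pendant-adjacent : ∀ {i j} → toℕ i ≡ toℕ j → dist G (clique i) (pendant j) ≡ 1
    dist-clique-pendant-adjacent {i} {j} i≡j = dist-suc G _ _ 0 (reach-adj G _ _ (clique-adj-pendant i≡j))
      (eqFin-≢ (clique≢pendant i j)) 1<n

    dist-pendant-clique-adjacent : ∀ {i j} → toℕ i ≡ toℕ j → dist G (pendant j) (clique i) ≡ 1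
    dist-pendant-clique-adjacent {i} {j} i≡j = dist-suc G _ _ 0 (reach-adj G _ _ (pendant-adj-clique i≡j))
      (eqFin-≢ (clique≢pendant i j ∘ sym)) 1<n

    dist-clique-pendant-far : ∀ {i j} → toℕ i ≢ toℕ j → dist G (clique i) (pendant j) ≡ 2
    dist-clique-pendant-far {i} {j} i≢j = dist-suc G _ _ 1
      (reach-step G 1 (clique i) (clique (partner j)) (pendant j)
        (reach-adj G _ _ (clique-adj-clique (≢-partner i≢j))) (clique-adj-pendant (toℕ-partner j)))
      (reach-one-false G (clique≢pendant i j) (trans (adj-clique-pendant i j) (eqℕ-≢ i≢j)))
      2<n

    dist-pendant-clique-far : ∀ {i j} → toℕ i ≢ toℕ j → dist G (pendant j) (clique i) ≡ 2
    dist-pendant-clique-far {i} {j} i≢j = dist-suc G _ _ 1 (reach-pendant-clique i≢j)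
      (reach-one-false G (clique≢pendant i j ∘ sym) (trans (adj-pendant-clique j i) (eqℕ-≢ (i≢j ∘ sym))))
      2<n

    pendant-neighbour : ∀ {j k} → reach G 1 (pendant j) (clique k) ≡ true → toℕ j ≡ toℕ k
    pendant-neighbour {j} {k} reached = eqℕ-sound _ _ (begin
      eqℕ (toℕ j) (toℕ k)                                          ≡⟨ adj-pendant-clique j k ⟨
      adj G (pendant j) (clique k)                                 ≡⟨ cong (_∨ adj G (pendant j) (clique k))
                                                                           (eqFin-≢ (clique≢pendant k j ∘ sym)) ⟨
      eqFin (pendant j) (clique k) ∨ adj G (pendant j) (clique k)  ≡⟨ reach-one G _ _ ⟨
      reach G 1 (pendant j) (clique k)                             ≡⟨ reached ⟩
      true                                                         ∎)

    unreachable-pendant-pendant : ∀ {j j′} → j ≢ j′ → reach G 2 (pendant j) (pendant j′) ≡ false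
    unreachable-pendant-pendant {j} {j′} j≢j′ = reach-suc-false G 1 _ _
      (reach-one-false G (j≢j′ ∘ ↑ʳ-injective s j j′) (adj-pendant-pendant j j′))
      (vertex-cases (λ w → reach G 1 (pendant j) w ≡ true → adj G w (pendant j′) ≡ false)
        (λ k reached → trans (adj-clique-pendant k j′)
                             (eqℕ-≢ λ k≡j′ → j≢j′ (toℕ-injective (trans (pendant-neighbour reached) k≡j′))))
        (λ k _ → adj-pendant-pendant k j′))

    dist-pendant-pendant : ∀ {j j′} → j ≢ j′ → dist G (pendant j) (pendant j′) ≡ 3
    dist-pendant-pendant {j} {j′} j≢j′ = dist-suc G _ _ 2
      (reach-step G 2 (pendant j) (clique (partner j′)) (pendant j′)
        (reach-pendant-clique λ pj′≡j → j≢j′ (sym (toℕ-injective (trans (sym (toℕ-partner j′)) pj′≡j))))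
        (clique-adj-pendant (toℕ-partner j′)))
      (unreachable-pendant-pendant j≢j′)
      3<n

    D-clique-clique : ∀ i i′ → D G (clique i) (clique i′) * D G (clique i′) (clique i)
                               ≡ (if eqFin i i′ then 0ℤ else 1ℤ)
    D-clique-clique i i′ with i ≟ i′
    ... | yes refl rewrite dist-self G (clique i) = refl
    ... | no i≢i′  rewrite dist-clique-clique i≢i′ | dist-clique-clique (i≢i′ ∘ sym) = refl

    D-clique-pendant : ∀ i j → D G (clique i) (pendant j) * D G (pendant j) (clique i)
                               ≡ (if eqℕ (toℕ i) (toℕ j) then 1ℤ else + 4)
    D-clique-pendant i j with toℕ i ℕ.≟ toℕ j
    ... | yes i≡j rewrite dist-clique-pendant-adjacent i≡j | dist-pendant-clique-adjacent i≡j
                        | eqℕ-complete i≡j = refl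
    ... | no i≢j  rewrite dist-clique-pendant-far i≢j | dist-pendant-clique-far i≢j | eqℕ-≢ i≢j = refl

    D-pendant-clique : ∀ j i → D G (pendant j) (clique i) * D G (clique i) (pendant j)
                               ≡ (if eqℕ (toℕ j) (toℕ i) then 1ℤ else + 4)
    D-pendant-clique j i with toℕ i ℕ.≟ toℕ j
    ... | yes i≡j rewrite dist-clique-pendant-adjacent i≡j | dist-pendant-clique-adjacent i≡j
                        | eqℕ-complete (sym i≡j) = refl
    ... | no i≢j  rewrite dist-clique-pendant-far i≢j | dist-pendant-clique-far i≢j
                        | eqℕ-≢ (i≢j ∘ sym) = refl

    D-pendant-pendant : ∀ j j′ → D G (pendant j) (pendant j′) * D G (pendant j′) (pendant j)
                                 ≡ (if eqFin j j′ then 0ℤ else + 9)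
    D-pendant-pendant j j′ with j ≟ j′
    ... | yes refl rewrite dist-self G (pendant j) = refl
    ... | no j≢j′  rewrite dist-pendant-pendant j≢j′ | dist-pendant-pendant (j≢j′ ∘ sym) = refl

-- The clique vertices k ↑ˡ r carry a pendant vertex, the vertices t ↑ʳ k do not.
module K-traceSq (a r : ℕ) where
  t s : ℕ
  t = suc (suc a)
  s = t ℕ.+ r

  private
    G = K s t
    3<n : 3 < s ℕ.+ t
    3<n = s≤s (s≤s (ℕP.≤-trans (s≤s (s≤s z≤n)) (ℕP.m≤n+m t (a ℕ.+ r))))
  open K-graph s t
  open Distances (ℕP.m≤m+n t r) 3<n

  D²-term : Fin (s ℕ.+ t) → Fin (s ℕ.+ t) → ℤ
  D²-term u v = D G u v * D G v u

  D²-diagonal : Fin (s ℕ.+ t) → ℤ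
  D²-diagonal u = ∑[ v < s ℕ.+ t ] D²-term u v

  D²-diagonal-split : ∀ u → D²-diagonal u ≡ ∑[ i < s ] D²-term u (clique i) + ∑[ j < t ] D²-term u (pendant j)
  D²-diagonal-split u = sum-++ s t (D²-term u)

  eqℕ-near : ∀ (k j : Fin t) → eqℕ (toℕ (k ↑ˡ r)) (toℕ j) ≡ eqFin k j
  eqℕ-near k j = trans (cong (λ m → eqℕ m (toℕ j)) (toℕ-↑ˡ k r)) (eqℕ-toℕ k j)

  toℕ-far≢ : ∀ (k : Fin r) (j : Fin t) → toℕ (t ↑ʳ k) ≢ toℕ j
  toℕ-far≢ k j eq = ℕP.<⇒≢ j<t+k (sym eq)
    where
    j<t+k : toℕ j < toℕ (t ↑ʳ k)
    j<t+k = ℕP.<-≤-trans (toℕ<n j) (ℕP.≤-trans (ℕP.m≤m+n t (toℕ k)) (ℕP.≤-reflexive (sym (toℕ-↑ʳ t k))))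

  D²-clique-clique : ∀ i → ∑[ i′ < s ] D²-term (clique i) (clique i′) ≡ 0ℤ + + suc (a ℕ.+ r) * 1ℤ
  D²-clique-clique i = trans (sum-cong-≗ (D-clique-clique i)) (sum-indicator i 0ℤ 1ℤ)

  near-value far-value pendant-value : ℤ
  near-value    = (0ℤ + + suc (a ℕ.+ r) * 1ℤ) + (1ℤ + + suc a * + 4)
  far-value     = (0ℤ + + suc (a ℕ.+ r) * 1ℤ) + + t * + 4
  pendant-value = ((1ℤ + + suc a * + 4) + + r * + 4) + (0ℤ + + suc a * + 9)

  D²-clique-near : ∀ k → D²-diagonal (clique (k ↑ˡ r)) ≡ near-value
  D²-clique-near k = trans (D²-diagonal-split (clique (k ↑ˡ r))) (cong₂ _+_ (D²-clique-clique (k ↑ˡ r)) (begin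
    ∑[ j < t ] D²-term (clique (k ↑ˡ r)) (pendant j)
      ≡⟨ sum-cong-≗ (λ j → trans (D-clique-pendant (k ↑ˡ r) j)
                                 (cong (if_then 1ℤ else + 4) (eqℕ-near k j))) ⟩
    ∑[ j < t ] (if eqFin k j then 1ℤ else + 4)
      ≡⟨ sum-indicator k 1ℤ (+ 4) ⟩
    1ℤ + + suc a * + 4
      ∎))

  D²-clique-far : ∀ k → D²-diagonal (clique (t ↑ʳ k)) ≡ far-value
  D²-clique-far k = trans (D²-diagonal-split (clique (t ↑ʳ k))) (cong₂ _+_ (D²-clique-clique (t ↑ʳ k)) (begin
    ∑[ j < t ] D²-term (clique (t ↑ʳ k)) (pendant j)
      ≡⟨ sum-cong-≗ (λ j → trans (D-clique-pendant (t ↑ʳ k) j)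
                                 (cong (if_then 1ℤ else + 4) (eqℕ-≢ (toℕ-far≢ k j)))) ⟩
    ∑[ j < t ] (+ 4)
      ≡⟨ sum-const t (+ 4) ⟩
    + t * + 4
      ∎))

  D²-pendant : ∀ j → D²-diagonal (pendant j) ≡ pendant-value
  D²-pendant j = trans (D²-diagonal-split (pendant j)) (cong₂ _+_ (begin
    ∑[ i < s ] D²-term (pendant j) (clique i)
      ≡⟨ sum-cong-≗ (D-pendant-clique j) ⟩
    ∑[ i < s ] (if eqℕ (toℕ j) (toℕ i) then 1ℤ else + 4)
      ≡⟨ sum-++ t r (λ i → if eqℕ (toℕ j) (toℕ i) then 1ℤ else + 4) ⟩
    ∑[ k < t ] (if eqℕ (toℕ j) (toℕ (k ↑ˡ r)) then 1ℤ else + 4)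
      + ∑[ k < r ] (if eqℕ (toℕ j) (toℕ (t ↑ʳ k)) then 1ℤ else + 4)
      ≡⟨ cong₂ _+_ (sum-cong-≗ λ k → cong (if_then 1ℤ else + 4)
                                         (trans (cong (eqℕ (toℕ j)) (toℕ-↑ˡ k r)) (eqℕ-toℕ j k)))
                   (sum-cong-≗ λ k → cong (if_then 1ℤ else + 4) (eqℕ-≢ (toℕ-far≢ k j ∘ sym))) ⟩
    ∑[ k < t ] (if eqFin j k then 1ℤ else + 4) + ∑[ k < r ] (+ 4)
      ≡⟨ cong₂ _+_ (sum-indicator j 1ℤ (+ 4)) (sum-const r (+ 4)) ⟩
    (1ℤ + + suc a * + 4) + + r * + 4
      ∎)
    (trans (sum-cong-≗ (D-pendant-pendant j)) (sum-indicator j 0ℤ (+ 9))))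

  traceSq-D : traceSq (D G) ≡ + t * near-value + + r * far-value + + t * pendant-value
  traceSq-D = begin
    ∑[ u < s ℕ.+ t ] D²-diagonal u
      ≡⟨ sum-++ s t D²-diagonal ⟩
    ∑[ i < s ] D²-diagonal (clique i) + ∑[ j < t ] D²-diagonal (pendant j)
      ≡⟨ cong (_+ ∑[ j < t ] D²-diagonal (pendant j)) (sum-++ t r (D²-diagonal ∘ clique)) ⟩
    ∑[ k < t ] D²-diagonal (clique (k ↑ˡ r)) + ∑[ k < r ] D²-diagonal (clique (t ↑ʳ k))
      + ∑[ j < t ] D²-diagonal (pendant j)
      ≡⟨ cong₂ _+_ (cong₂ _+_ (trans (sum-cong-≗ D²-clique-near) (sum-const t near-value))
                              (trans (sum-cong-≗ D²-clique-far) (sum-const r far-value)))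
                   (trans (sum-cong-≗ D²-pendant) (sum-const t pendant-value)) ⟩
    + t * near-value + + r * far-value + + t * pendant-value
      ∎

-- Σ d² over ordered pairs: s(s − 1)·1 + 2t·1 + 2t(s − 1)·4 + t(t − 1)·9 with s = n − t.
traceD²K : ℕ → ℕ → ℤ
traceD²K n t = + n * + n + + 6 * + n * + t + + 2 * + t * + t - + n - + 14 * + t

traceSq-D-K : ∀ {s t} → 2 ≤ t → t ≤ s → traceSq (D (K s t)) ≡ traceD²K (s ℕ.+ t) t
traceSq-D-K {s} {suc (suc a)} (s≤s (s≤s z≤n)) t≤s with ℕP.m≤n⇒∃[o]m+o≡n t≤s
... | r , refl = trans (K-traceSq.traceSq-D a r) (closed-form (+ a) (+ r))
  where
  closed-form : ∀ a r →
      (+ 2 + a) * ((0ℤ + (1ℤ + (a + r)) * 1ℤ) + (1ℤ + (1ℤ + a) * + 4))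
    + r * ((0ℤ + (1ℤ + (a + r)) * 1ℤ) + (+ 2 + a) * + 4)
    + (+ 2 + a) * (((1ℤ + (1ℤ + a) * + 4) + r * + 4) + (0ℤ + (1ℤ + a) * + 9))
    ≡ ((+ 2 + a + r) + (+ 2 + a)) * ((+ 2 + a + r) + (+ 2 + a))
      + + 6 * ((+ 2 + a + r) + (+ 2 + a)) * (+ 2 + a) + + 2 * (+ 2 + a) * (+ 2 + a)
      - ((+ 2 + a + r) + (+ 2 + a)) - + 14 * (+ 2 + a)
  closed-form = solve-∀

traceD²K-injective : ∀ {n t₁ t₂} → 3 ≤ n → traceD²K n t₁ ≡ traceD²K n t₂ → t₁ ≡ t₂
traceD²K-injective {suc (suc (suc n))} {t₁} {t₂} (s≤s (s≤s (s≤s z≤n))) eq =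
  [ (λ t₁-t₂≡0 → ℤP.+-injective (ℤP.i-j≡0⇒i≡j (+ t₁) (+ t₂) t₁-t₂≡0))
  , (λ factor≡0 → ⊥-elim (factor≢0 factor≡0))
  ]′
  (ℤP.i*j≡0⇒i≡0∨j≡0 (+ t₁ - + t₂) (begin
    (+ t₁ - + t₂) * factor                         ≡⟨ difference (+ n) (+ t₁) (+ t₂) ⟨
    traceD²K (3 ℕ.+ n) t₁ - traceD²K (3 ℕ.+ n) t₂  ≡⟨ cong (_- traceD²K (3 ℕ.+ n) t₂) eq ⟩
    traceD²K (3 ℕ.+ n) t₂ - traceD²K (3 ℕ.+ n) t₂  ≡⟨ ℤP.+-inverseʳ (traceD²K (3 ℕ.+ n) t₂) ⟩
    0ℤ                                             ∎))
  where
  factor : ℤ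
  factor = + 4 + (+ 6 * + n + + 2 * + t₁ + + 2 * + t₂)
  factor≢0 : factor ≢ 0ℤ
  factor≢0 rewrite sym (ℤP.pos-* 6 n) | sym (ℤP.pos-* 2 t₁) | sym (ℤP.pos-* 2 t₂) = λ ()
  difference : ∀ n t₁ t₂ →
      ((+ 3 + n) * (+ 3 + n) + + 6 * (+ 3 + n) * t₁ + + 2 * t₁ * t₁ - (+ 3 + n) - + 14 * t₁)
    - ((+ 3 + n) * (+ 3 + n) + + 6 * (+ 3 + n) * t₂ + + 2 * t₂ * t₂ - (+ 3 + n) - + 14 * t₂)
    ≡ (t₁ - t₂) * (+ 4 + (+ 6 * n + + 2 * t₁ + + 2 * t₂))
  difference = solve-∀

K-cong : ∀ {s₁ t₁ s₂ t₂} → s₁ ≡ s₂ → t₁ ≡ t₂ → K s₁ t₁ ≅ K s₂ t₂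
K-cong refl refl = ↔-refl , λ u v → refl

theorem3p3 : (n s₁ t₁ s₂ t₂ : ℕ) →
    2 ≤ t₁ → t₁ ≤ s₁ → s₁ ℕ.+ t₁ ≡ n →
    2 ≤ t₂ → t₂ ≤ s₂ → s₂ ℕ.+ t₂ ≡ n →
    DCospectral (K s₁ t₁) (K s₂ t₂) →
    K s₁ t₁ ≅ K s₂ t₂
theorem3p3 n s₁ t₁ s₂ t₂ 2≤t₁ t₁≤s₁ refl 2≤t₂ t₂≤s₂ n₂≡n cospectral =
  K-cong (ℕP.+-cancelʳ-≡ t₂ s₁ s₂ (trans (cong (s₁ ℕ.+_) (sym t₁≡t₂)) (sym n₂≡n))) t₁≡t₂
  where
  3≤n : 3 ≤ s₁ ℕ.+ t₁
  3≤n = ℕP.≤-trans (ℕP.n≤1+n 3) (ℕP.+-mono-≤ (ℕP.≤-trans 2≤t₁ t₁≤s₁) 2≤t₁)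
  t₁≡t₂ : t₁ ≡ t₂
  t₁≡t₂ = traceD²K-injective 3≤n (begin
    traceD²K (s₁ ℕ.+ t₁) t₁  ≡⟨ traceSq-D-K 2≤t₁ t₁≤s₁ ⟨
    traceSq (D (K s₁ t₁))    ≡⟨ cospectral⇒traceSq≡ _ _ (sym n₂≡n) (D-hollow _) (D-hollow _) cospectral ⟩
    traceSq (D (K s₂ t₂))    ≡⟨ traceSq-D-K 2≤t₂ t₂≤s₂ ⟩
    traceD²K (s₂ ℕ.+ t₂) t₂  ≡⟨ cong (λ m → traceD²K m t₂) n₂≡n ⟩
    traceD²K (s₁ ℕ.+ t₁) t₂  ∎)
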